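{- Let $G$ be a graph and $k$ a positive integer. There is a sequence of at most $k$ exclusive vertex splits transforming $G$ into a bipartite graph if and only if there is a set $S\subseteq V(G)$ with $|S|\le k$ such that $G-S$ is bipartite.
   Context: All graphs are finite, simple and undirected. An exclusive vertex split of a vertex $v$ removes $v$ and adds two new vertices $v_1,v_2$ with $N(v_1)\cup N(v_2)=N(v)$ and $N(v_1)\cap N(v_2)=\emptyset$; no other adjacencies change. $G-S$ denotes the subgraph induced by $V(G)\setminus S$. -}

module Defs where

open import Level using (0ℓ)
open import Data.Bool using (Bool)
open import Data.Nat using (ℕ; zero; suc)
open import Data.Fin using (Fin; inject₁; fromℕ)
open import Data.Fin.Subset using (Subset; _∈_; _∉_)
open import Data.Product using (Σ; _×_; ∃; _,_)
open import Data.Sum using (_⊎_)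
open import Relation.Nullary using (¬_)
open import Relation.Binary.PropositionalEquality using (_≡_; _≢_)
open import Function.Bundles using (_⇔_)

record Graph (V : Set) : Set₁ where
  field
    Adj    : V → V → Set
    sym    : ∀ {x y} → Adj x y → Adj y x
    irrefl : ∀ {x} → ¬ Adj x x
open Graph public

Bipartite : ∀ {V} → Graph V → Set
Bipartite {V} G = Σ (V → Bool) λ c → ∀ x y → Adj G x y → c x ≢ c y

Remaining : ∀ {n} → Subset n → Set
Remaining {n} S = Σ (Fin n) λ x → x ∉ S

_─_ : ∀ {n} → Graph (Fin n) → (S : Subset n) → Graph (Remaining S)
Adj    (G ─ S) (x , _) (y , _) = Adj G x y
sym    (G ─ S) a = sym G a
irrefl (G ─ S) a = irrefl G a

-- Vertex labelling convention: every old vertex x ≠ v keeps label inject₁ x,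
-- v₁ is inject₁ v and v₂ is the new vertex fromℕ n.
record ExclusiveSplit {n} (G : Graph (Fin n)) (v : Fin n) (H : Graph (Fin (suc n))) : Set where
  field
    unchanged : ∀ x y → x ≢ v → y ≢ v → (Adj H (inject₁ x) (inject₁ y) ⇔ Adj G x y)
    -- N(v₁) ∪ N(v₂) = N(v)  (restricted to old vertices; v₁v₂ forbids v₁ ~ v₂)
    union     : ∀ y → y ≢ v →
                (Adj G v y ⇔ (Adj H (inject₁ v) (inject₁ y) ⊎ Adj H (fromℕ n) (inject₁ y)))
    v₁v₂      : ¬ Adj H (inject₁ v) (fromℕ n)
    disjoint  : ∀ w → ¬ (Adj H (inject₁ v) w × Adj H (fromℕ n) w)

data Splits : ∀ {n m} → Graph (Fin n) → Graph (Fin m) → ℕ → Set₁ where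
  done : ∀ {n} {G : Graph (Fin n)} → Splits G G zero
  step : ∀ {n m j} {G : Graph (Fin n)} {G′ : Graph (Fin (suc n))} {H : Graph (Fin m)}
         (v : Fin n) → ExclusiveSplit G v G′ → Splits G′ H j → Splits G H (suc j)

{-# OPTIONS --safe #-}
-- Given a 2-colouring c of G - S and v ∈ S, split v into v₁, adjacent to the neighbours of v
-- coloured differently from v, and v₂, adjacent to the others and coloured opposite to v: c
-- extends to a 2-colouring of the split graph minus S ∖ {v}. So |S| splits make G bipartite.
-- Conversely, deleting from G every vertex one of whose copies is split leaves an induced
-- subgraph of the final, bipartite graph.
module Submission where

open import Defs hiding (sym)
open import Data.Nat using (ℕ; zero; suc; _≤_; _<_; _+_; z≤n; s≤s)
open import Data.Nat.Properties
  using (≤-trans; ≤-reflexive; +-monoʳ-≤; +-comm; +-suc; ≤-<-trans; ≤-pred; module ≤-Reasoning)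
open import Data.Fin using (Fin; zero; suc; inject₁; fromℕ)
open import Data.Fin.Properties using (_≟_)
open import Data.Fin.Relation.Unary.Top using (view; ‵fromℕ; ‵inject₁)
open import Data.Fin.Subset using (Subset; ∣_∣; _∈_; _∉_; _∪_; ⁅_⁆; _-_; ⊥; inside; outside; Empty)
open import Data.Fin.Subset.Properties
  using (_∈?_; nonempty?; ∣p∣≤∣x∷p∣; ∣⁅x⁆∣≡1; ∣⊥∣≡0; x∈p∪q⁺; x∈⁅x⁆; x∈p∧x≢y⇒x∈p-y; x∈p⇒∣p-x∣<∣p∣)
open import Data.Vec using ([]; _∷_; here; there; _∷ʳ_; init; initLast)
open import Data.Vec.Functional using (insertAt)
open import Data.Bool using (Bool; false; not)
open import Data.Bool.Properties using (not-¬; ¬-not) renaming (_≟_ to _≟ᵇ_)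
open import Data.Product using (Σ; ∃; _×_; _,_; proj₁; proj₂)
open import Data.Sum using (_⊎_; inj₁; inj₂; [_,_]; swap)
open import Data.Empty using (⊥-elim)
open import Function using (_∘_; id)
open import Relation.Nullary using (¬_; yes; no; contradiction)
open import Relation.Binary.PropositionalEquality using (_≡_; _≢_; refl; sym; cong; ≢-sym)
open import Function.Bundles using (_⇔_; mk⇔; Equivalence)

private
  variable
    n : ℕ
    x : Fin n

∣p∪q∣≤∣p∣+∣q∣ : ∀ (p q : Subset n) → ∣ p ∪ q ∣ ≤ ∣ p ∣ + ∣ q ∣
∣p∪q∣≤∣p∣+∣q∣ []            []            = z≤n
∣p∪q∣≤∣p∣+∣q∣ (inside  ∷ p) (s       ∷ q) = s≤s (≤-trans (∣p∪q∣≤∣p∣+∣q∣ p q) (+-monoʳ-≤ ∣ p ∣ (∣p∣≤∣x∷p∣ s q)))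
∣p∪q∣≤∣p∣+∣q∣ (outside ∷ p) (inside  ∷ q) = ≤-trans (s≤s (∣p∪q∣≤∣p∣+∣q∣ p q)) (≤-reflexive (sym (+-suc ∣ p ∣ ∣ q ∣)))
∣p∪q∣≤∣p∣+∣q∣ (outside ∷ p) (outside ∷ q) = ∣p∪q∣≤∣p∣+∣q∣ p q

∣p∪⁅x⁆∣≤1+∣p∣ : ∀ (p : Subset n) x → ∣ p ∪ ⁅ x ⁆ ∣ ≤ suc ∣ p ∣
∣p∪⁅x⁆∣≤1+∣p∣ p x = begin
  ∣ p ∪ ⁅ x ⁆ ∣     ≤⟨ ∣p∪q∣≤∣p∣+∣q∣ p ⁅ x ⁆ ⟩
  ∣ p ∣ + ∣ ⁅ x ⁆ ∣ ≡⟨ +-comm ∣ p ∣ ∣ ⁅ x ⁆ ∣ ⟩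
  ∣ ⁅ x ⁆ ∣ + ∣ p ∣ ≡⟨ cong (_+ ∣ p ∣) (∣⁅x⁆∣≡1 x) ⟩
  suc ∣ p ∣         ∎
  where open ≤-Reasoning

∣p∣≤∣p∷ʳs∣ : ∀ (p : Subset n) s → ∣ p ∣ ≤ ∣ p ∷ʳ s ∣
∣p∣≤∣p∷ʳs∣ []            s = z≤n
∣p∣≤∣p∷ʳs∣ (inside  ∷ p) s = s≤s (∣p∣≤∣p∷ʳs∣ p s)
∣p∣≤∣p∷ʳs∣ (outside ∷ p) s = ∣p∣≤∣p∷ʳs∣ p s

∣p∷ʳoutside∣≡∣p∣ : ∀ (p : Subset n) → ∣ p ∷ʳ outside ∣ ≡ ∣ p ∣
∣p∷ʳoutside∣≡∣p∣ []            = refl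
∣p∷ʳoutside∣≡∣p∣ (inside  ∷ p) = cong suc (∣p∷ʳoutside∣≡∣p∣ p)
∣p∷ʳoutside∣≡∣p∣ (outside ∷ p) = ∣p∷ʳoutside∣≡∣p∣ p

x∈p⇒inject₁[x]∈p∷ʳs : ∀ {p : Subset n} s → x ∈ p → inject₁ x ∈ p ∷ʳ s
x∈p⇒inject₁[x]∈p∷ʳs {p = _ ∷ p} s here       = here
x∈p⇒inject₁[x]∈p∷ʳs {p = _ ∷ p} s (there x∈p) = there (x∈p⇒inject₁[x]∈p∷ʳs s x∈p)

inject₁[x]∈p∷ʳs⇒x∈p : ∀ (p : Subset n) {s} → inject₁ x ∈ p ∷ʳ s → x ∈ p
inject₁[x]∈p∷ʳs⇒x∈p {x = zero}  (_ ∷ p) here        = here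
inject₁[x]∈p∷ʳs⇒x∈p {x = suc x} (_ ∷ p) (there x∈p) = there (inject₁[x]∈p∷ʳs⇒x∈p p x∈p)

inject₁[x]∈p⇒x∈init[p] : ∀ (p : Subset (suc n)) → inject₁ x ∈ p → x ∈ init p
inject₁[x]∈p⇒x∈init[p] p x∈p with initLast p
... | q , _ , refl = inject₁[x]∈p∷ʳs⇒x∈p q x∈p

∣init[p]∣≤∣p∣ : ∀ (p : Subset (suc n)) → ∣ init p ∣ ≤ ∣ p ∣
∣init[p]∣≤∣p∣ p with initLast p
... | q , s , refl = ∣p∣≤∣p∷ʳs∣ q s

insertAt-fromℕ-inject₁ : ∀ {A : Set} (f : Fin n → A) a (x : Fin n) → insertAt f (fromℕ n) a (inject₁ x) ≡ f x
insertAt-fromℕ-inject₁ f a zero    = refl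
insertAt-fromℕ-inject₁ f a (suc x) = insertAt-fromℕ-inject₁ (f ∘ suc) a x

insertAt-fromℕ-fromℕ : ∀ {A : Set} (f : Fin n → A) a → insertAt f (fromℕ n) a (fromℕ n) ≡ a
insertAt-fromℕ-fromℕ {n = zero}  f a = refl
insertAt-fromℕ-fromℕ {n = suc n} f a = insertAt-fromℕ-fromℕ (f ∘ suc) a

ProperOutside : Graph (Fin n) → Subset n → (Fin n → Bool) → Set
ProperOutside G S c = ∀ {x y} → x ∉ S → y ∉ S → Adj G x y → c x ≢ c y

bipartite[G─S]⇔properOutside : ∀ (G : Graph (Fin n)) S → Bipartite (G ─ S) ⇔ ∃ (ProperOutside G S)
bipartite[G─S]⇔properOutside G S = mk⇔ extend restrict
  where
  extend : Bipartite (G ─ S) → ∃ (ProperOutside G S)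
  extend (c , proper) = colour , proper′
    where
    colour : Fin _ → Bool
    colour x with x ∈? S
    ... | yes _   = false
    ... | no  x∉S = c (x , x∉S)

    proper′ : ProperOutside G S colour
    proper′ {x} {y} x∉S y∉S xy with x ∈? S | y ∈? S
    ... | yes x∈S | _       = contradiction x∈S x∉S
    ... | no  _   | yes y∈S = contradiction y∈S y∉S
    ... | no  x∉S | no  y∉S = proper (x , x∉S) (y , y∉S) xy

  restrict : ∃ (ProperOutside G S) → Bipartite (G ─ S)
  restrict (c , proper) = (λ (x , _) → c x) , λ (_ , x∉S) (_ , y∉S) → proper x∉S y∉S

module ColourSplit (G : Graph (Fin n)) (v : Fin n) (c : Fin n → Bool) where

  origin : Fin (suc n) → Fin n
  origin = insertAt id (fromℕ n) v

  colour : Fin (suc n) → Bool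
  colour = insertAt c (fromℕ n) (not (c v))

  AtV : Fin (suc n) → Fin (suc n) → Set
  AtV z w = origin z ≡ v ⊎ origin w ≡ v

  splitGraph : Graph (Fin (suc n))
  splitGraph = record
    { Adj    = λ z w → Adj G (origin z) (origin w) × (AtV z w → colour z ≢ colour w)
    ; sym    = λ (zw , proper) → Graph.sym G zw , ≢-sym ∘ proper ∘ swap
    ; irrefl = irrefl G ∘ proj₁
    }

  origin-inject₁ : ∀ x → origin (inject₁ x) ≡ x
  origin-inject₁ = insertAt-fromℕ-inject₁ id v

  origin-fromℕ : origin (fromℕ n) ≡ v
  origin-fromℕ = insertAt-fromℕ-fromℕ id v

  colour-inject₁ : ∀ x → colour (inject₁ x) ≡ c x
  colour-inject₁ = insertAt-fromℕ-inject₁ c (not (c v))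

  colour-fromℕ : colour (fromℕ n) ≡ not (c v)
  colour-fromℕ = insertAt-fromℕ-fromℕ c (not (c v))

  isExclusiveSplit : ExclusiveSplit G v splitGraph
  isExclusiveSplit = record
    { unchanged = unchanged
    ; union     = union
    ; v₁v₂      = v₁v₂
    ; disjoint  = disjoint
    }
    where
    unchanged : ∀ x y → x ≢ v → y ≢ v → Adj splitGraph (inject₁ x) (inject₁ y) ⇔ Adj G x y
    unchanged x y x≢v y≢v rewrite origin-inject₁ x | origin-inject₁ y =
      mk⇔ proj₁ (λ xy → xy , [ ⊥-elim ∘ x≢v , ⊥-elim ∘ y≢v ])

    union : ∀ y → y ≢ v →
            Adj G v y ⇔ (Adj splitGraph (inject₁ v) (inject₁ y) ⊎ Adj splitGraph (fromℕ n) (inject₁ y))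
    union y _ rewrite origin-inject₁ v | origin-inject₁ y | origin-fromℕ
                    | colour-inject₁ v | colour-inject₁ y | colour-fromℕ = mk⇔ to [ proj₁ , proj₁ ]
      where
      to : Adj G v y → Adj G v y × (v ≡ v ⊎ y ≡ v → c v ≢ c y) ⊎ Adj G v y × (v ≡ v ⊎ y ≡ v → not (c v) ≢ c y)
      to vy with c v ≟ᵇ c y
      ... | yes same = inj₂ (vy , λ _ → ≢-sym (not-¬ (sym same)))
      ... | no  diff = inj₁ (vy , λ _ → diff)

    v₁v₂ : ¬ Adj splitGraph (inject₁ v) (fromℕ n)
    v₁v₂ rewrite origin-inject₁ v | origin-fromℕ = irrefl G ∘ proj₁

    disjoint : ∀ w → ¬ (Adj splitGraph (inject₁ v) w × Adj splitGraph (fromℕ n) w)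
    disjoint w ((_ , proper₁) , (_ , proper₂))
      rewrite colour-inject₁ v | colour-fromℕ =
      proper₂ (inj₁ origin-fromℕ) (sym (¬-not (≢-sym (proper₁ (inj₁ (origin-inject₁ v))))))

  colour-away-from-v : ∀ z → origin z ≢ v → colour z ≡ c (origin z)
  colour-away-from-v z oz≢v with view z
  ... | ‵fromℕ     = contradiction origin-fromℕ oz≢v
  ... | ‵inject₁ x rewrite colour-inject₁ x | origin-inject₁ x = refl

  origin∉S : ∀ {S z} → z ∉ (S - v) ∷ʳ outside → origin z ≢ v → origin z ∉ S
  origin∉S {S} {z} z∉S′ oz≢v with view z
  ... | ‵fromℕ     = contradiction origin-fromℕ oz≢v
  ... | ‵inject₁ x rewrite origin-inject₁ x =
    λ x∈S → z∉S′ (x∈p⇒inject₁[x]∈p∷ʳs outside (x∈p∧x≢y⇒x∈p-y x∈S oz≢v))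

  colour-properOutside : ∀ {S} → ProperOutside G S c → ProperOutside splitGraph ((S - v) ∷ʳ outside) colour
  colour-properOutside proper {z} {w} z∉S′ w∉S′ (zw , properAtV) with origin z ≟ v | origin w ≟ v
  ... | yes oz≡v | _        = properAtV (inj₁ oz≡v)
  ... | no  _    | yes ow≡v = properAtV (inj₂ ow≡v)
  ... | no  oz≢v | no  ow≢v rewrite colour-away-from-v z oz≢v | colour-away-from-v w ow≢v =
    proper (origin∉S z∉S′ oz≢v) (origin∉S w∉S′ ow≢v) zw

properOutside-split : ∀ {G : Graph (Fin n)} {S c v} → v ∈ S → ProperOutside G S c →
  Σ (Graph (Fin (suc n))) λ G′ → ExclusiveSplit G v G′ ×
    Σ (Subset (suc n)) λ S′ → ∣ S′ ∣ < ∣ S ∣ × ∃ (ProperOutside G′ S′)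
properOutside-split {G = G} {S} {c} {v} v∈S proper =
  splitGraph , isExclusiveSplit ,
  (S - v) ∷ʳ outside , ≤-<-trans (≤-reflexive (∣p∷ʳoutside∣≡∣p∣ (S - v))) (x∈p⇒∣p-x∣<∣p∣ v∈S) ,
  colour , colour-properOutside proper
  where open ColourSplit G v c

properOutside-∅⇒bipartite : ∀ {G : Graph (Fin n)} {S c} → Empty S → ProperOutside G S c → Bipartite G
properOutside-∅⇒bipartite {c = c} S-empty proper =
  c , λ x y → proper (S-empty ∘ (x ,_)) (S-empty ∘ (y ,_))

BipartiteWithinSplits : Graph (Fin n) → ℕ → Set₁
BipartiteWithinSplits G k = Σ ℕ λ m → Σ (Graph (Fin m)) λ H → Σ ℕ λ j → j ≤ k × Splits G H j × Bipartite H

BipartiteWithinDeletions : Graph (Fin n) → ℕ → Set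
BipartiteWithinDeletions {n} G k = Σ (Subset n) λ S → ∣ S ∣ ≤ k × Bipartite (G ─ S)

properOutside⇒bipartiteWithinSplits : ∀ k {G : Graph (Fin n)} {S c} → ∣ S ∣ ≤ k → ProperOutside G S c →
  BipartiteWithinSplits G k
properOutside⇒bipartiteWithinSplits k {G} {S} ∣S∣≤k proper with nonempty? S
... | no S-empty = _ , G , 0 , z≤n , done , properOutside-∅⇒bipartite {G = G} S-empty proper
properOutside⇒bipartiteWithinSplits zero ∣S∣≤0 _ | yes (_ , v∈S) =
  contradiction (≤-trans (x∈p⇒∣p-x∣<∣p∣ v∈S) ∣S∣≤0) λ ()
properOutside⇒bipartiteWithinSplits (suc k) ∣S∣≤1+k proper | yes (v , v∈S)
  with properOutside-split v∈S proper
... | _ , split , _ , ∣S′∣<∣S∣ , _ , proper′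
  with properOutside⇒bipartiteWithinSplits k (≤-pred (≤-trans ∣S′∣<∣S∣ ∣S∣≤1+k)) proper′
... | m , H , j , j≤k , splits , bipartite = m , H , suc j , s≤s j≤k , step v split splits , bipartite

unsplit-properOutside : ∀ {G : Graph (Fin n)} {v G′ S′ c} → ExclusiveSplit G v G′ → ProperOutside G′ S′ c →
  ProperOutside G (init S′ ∪ ⁅ v ⁆) (c ∘ inject₁)
unsplit-properOutside {v = v} {S′ = S′} split proper {x} {y} x∉S y∉S xy =
  proper (inject₁∉S′ x∉S) (inject₁∉S′ y∉S)
    (Equivalence.from (ExclusiveSplit.unchanged split x y (≢v x∉S) (≢v y∉S)) xy)
  where
  inject₁∉S′ : ∀ {z} → z ∉ init S′ ∪ ⁅ v ⁆ → inject₁ z ∉ S′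
  inject₁∉S′ z∉S z∈S′ = z∉S (x∈p∪q⁺ (inj₁ (inject₁[x]∈p⇒x∈init[p] S′ z∈S′)))

  ≢v : ∀ {z} → z ∉ init S′ ∪ ⁅ v ⁆ → z ≢ v
  ≢v z∉S refl = z∉S (x∈p∪q⁺ (inj₂ (x∈⁅x⁆ v)))

splits⇒properOutside : ∀ {m j} {G : Graph (Fin n)} {H : Graph (Fin m)} → Splits G H j → Bipartite H →
  Σ (Subset n) λ S → ∣ S ∣ ≤ j × ∃ (ProperOutside G S)
splits⇒properOutside {n} done (c , proper) = ⊥ , ≤-reflexive (∣⊥∣≡0 n) , c , λ _ _ → proper _ _
splits⇒properOutside (step v split splits) bipartite with splits⇒properOutside splits bipartite
... | S′ , ∣S′∣≤j , c , proper =
  init S′ ∪ ⁅ v ⁆ ,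
  ≤-trans (∣p∪⁅x⁆∣≤1+∣p∣ (init S′) v) (s≤s (≤-trans (∣init[p]∣≤∣p∣ S′) ∣S′∣≤j)) ,
  c ∘ inject₁ , unsplit-properOutside split proper

corollary6 : ∀ {n} (G : Graph (Fin n)) (k : ℕ) → 1 ≤ k →
    ((Σ ℕ λ m → Σ (Graph (Fin m)) λ H → Σ ℕ λ j → j ≤ k × Splits G H j × Bipartite H)
      ⇔ (Σ (Subset n) λ S → ∣ S ∣ ≤ k × Bipartite (G ─ S)))
corollary6 G k _ = mk⇔ fromSplits fromDeletions
  where
  fromSplits : BipartiteWithinSplits G k → BipartiteWithinDeletions G k
  fromSplits (_ , _ , _ , j≤k , splits , bipartite) with splits⇒properOutside splits bipartite
  ... | S , ∣S∣≤j , proper = S , ≤-trans ∣S∣≤j j≤k , Equivalence.from (bipartite[G─S]⇔properOutside G S) proper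

  fromDeletions : BipartiteWithinDeletions G k → BipartiteWithinSplits G k
  fromDeletions (S , ∣S∣≤k , bipartite) =
    properOutside⇒bipartiteWithinSplits k ∣S∣≤k (proj₂ (Equivalence.to (bipartite[G─S]⇔properOutside G S) bipartite))
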